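{- Let $\omega=(-1+\sqrt{ -3})/2$. For every positive integer $n$, $$\sum_{\substack{0\le k\le n\\ 6\mid k-3}}\binom nkB_{n-k}(x)=\frac n6\big(x^{n-1}+(x-1)^{n-1}-(x+\omega)^{n-1}-(x+\omega^2)^{n-1}\big).$$
   Context: The Bernoulli numbers $B_n$ are defined by $B_0=1$ and $\sum_{k=0}^{n-1}\binom nkB_k=0$ for $n\ge 2$; the Bernoulli polynomials are $B_n(x)=\sum_{k=0}^n\binom nkB_kx^{n-k}$ for $n\ge 0$. -}

module Defs where

open import Data.Nat as ℕ using (ℕ; zero; suc; _∸_)
open import Data.Nat.Combinatorics using (_C_)
open import Data.Integer as ℤ using (ℤ; +_)
open import Data.Integer.Divisibility.Signed using (_∣?_)
open import Data.Rational using (ℚ; 0ℚ; 1ℚ; _+_; _*_; _-_; -_; _/_)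
open import Data.List using (List; []; _∷_; _∷ʳ_)
open import Relation.Nullary using (does)
open import Data.Bool using (if_then_else_)

Σ< : ℕ → (ℕ → ℚ) → ℚ
Σ< zero    f = 0ℚ
Σ< (suc n) f = Σ< n f + f n

ℕ→ℚ : ℕ → ℚ
ℕ→ℚ n = + n / 1

_^ℚ_ : ℚ → ℕ → ℚ
x ^ℚ zero  = 1ℚ
x ^ℚ suc n = x * (x ^ℚ n)

-- list indexing with default 0 (only used in range)
idx : List ℚ → ℕ → ℚ
idx []       _       = 0ℚ
idx (a ∷ as) zero    = a
idx (a ∷ as) (suc k) = idx as k

-- Bernoulli numbers: B_0 = 1 and, for m ≥ 2, Σ_{k=0}^{m-1} C(m,k) B_k = 0,
-- solved for B_{m-1}:  B_{m-1} = -(1/m) Σ_{k=0}^{m-2} C(m,k) B_k.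
-- nextBern n t computes B_n from the list t = [B_0, …, B_{n-1}].
nextBern : ℕ → List ℚ → ℚ
nextBern zero    t = 1ℚ
nextBern (suc j) t =
  - ((+ 1 / suc (suc j)) * Σ< (suc j) (λ k → ℕ→ℚ (suc (suc j) C k) * idx t k))

bernTable : ℕ → List ℚ
bernTable zero    = []
bernTable (suc n) = bernTable n ∷ʳ nextBern n (bernTable n)

B : ℕ → ℚ
B n = idx (bernTable (suc n)) n

Bpoly : ℕ → ℚ → ℚ
Bpoly n x = Σ< (suc n) (λ k → ℕ→ℚ (n C k) * (B k * (x ^ℚ (n ∸ k))))

lhs : ℕ → ℚ → ℚ
lhs n x = Σ< (suc n) (λ k →
  if does ((+ 6) ∣? ((+ k) ℤ.- (+ 3)))
  then ℕ→ℚ (n C k) * Bpoly (n ∸ k) x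
  else 0ℚ)

-- ℚ(ω), ω = (-1+√-3)/2, elements a + bω represented as mkω a b; ω² = -1 - ω
record ℚω : Set where
  constructor mkω
  field
    re : ℚ
    im : ℚ

infixl 6 _⊕_ _⊖_
infixl 7 _⊗_

_⊕_ : ℚω → ℚω → ℚω
mkω a b ⊕ mkω c d = mkω (a + c) (b + d)

_⊖_ : ℚω → ℚω → ℚω
mkω a b ⊖ mkω c d = mkω (a - c) (b - d)

-- (a+bω)(c+dω) = ac + (ad+bc)ω + bd ω² = (ac - bd) + (ad + bc - bd) ω
_⊗_ : ℚω → ℚω → ℚω
mkω a b ⊗ mkω c d = mkω (a * c - b * d) (a * d + b * c - b * d)

ι : ℚ → ℚω
ι a = mkω a 0ℚ

ω : ℚω
ω = mkω 0ℚ 1ℚ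

_^ω_ : ℚω → ℕ → ℚω
z ^ω zero  = ι 1ℚ
z ^ω suc n = z ⊗ (z ^ω n)

rhs : ℕ → ℚ → ℚω
rhs n x = ι (+ n / 6) ⊗
  ((ι x ^ω (n ∸ 1)) ⊕ (ι (x - 1ℚ) ^ω (n ∸ 1))
    ⊖ ((ι x ⊕ ω) ^ω (n ∸ 1)) ⊖ ((ι x ⊕ (ω ⊗ ω)) ^ω (n ∸ 1)))

{-# OPTIONS --safe #-}
-- Let ζ run over the sixth roots of unity ±1, ±ω, ±ω², with sign −1 at −1, −ω, −ω².
-- By the Appell property B_n(x + z) = Σ_k C(n,k) B_{n-k}(x) z^k, the signed sum
-- Σ_ζ ± B_n(x + ζ) weights the k-th term by Σ_ζ ± ζ^k, which is 6 if k ≡ 3 (mod 6) and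
-- 0 otherwise; so it is 6 times the left-hand side.  On the other hand −ω = ω² + 1 and
-- −ω² = ω + 1, so the six values pair into differences B_n(y + 1) − B_n(y) = n y^{n-1} at
-- y = x, x − 1, x + ω, x + ω².  That difference equation is itself the Appell property at
-- z = 1 together with the defining recurrence, which says B_m(1) = B_m for m ≠ 1.
module Submission where

open import Defs
open import Algebra.Bundles using (CommutativeRing)
open import Data.Bool using (Bool; true; false; if_then_else_)
open import Data.Fin using (Fin; toℕ)
open import Data.Integer as ℤ using (+_)
open import Data.Integer.Divisibility.Signed using (_∣_; _∣?_; ∣m∣n⇒∣m+n; ∣m+n∣m⇒∣n; ∣-refl)
import Data.Integer.Tactic.RingSolver as ℤ-Ring
open import Data.List using ([]; _∷_; _∷ʳ_; length)
open import Data.List.Properties using (length-++)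
open import Data.Maybe using (Maybe; just; nothing)
open import Data.Nat as ℕ using (ℕ; zero; suc; _+_; _∸_; _≤_; _<_; _≥_; z≤n; s≤s; _!)
open import Data.Nat.Combinatorics
  using (_C_; nCk≡n!/k![n-k]!; k![n∸k]!∣n!; k>n⇒nCk≡0; nCk≡nC[n∸k]; nCn≡1; nC1≡n)
open import Data.Nat.DivMod using (m/n*n≡m)
import Data.Nat.Properties as ℕₚ
import Data.Nat.Tactic.RingSolver as ℕ-Ring
open import Data.Product using (_,_)
open import Data.Rational as ℚ using (ℚ; 0ℚ; 1ℚ)
import Data.Rational.Properties as ℚₚ
open import Data.Rational.Solver renaming (module +-*-Solver to ℚ-Solver)
open import Data.Rational.Unnormalised as ℚᵘ using (mkℚᵘ; *≡*)
import Data.Rational.Unnormalised.Properties as ℚᵘₚ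
open import Data.Sum using (inj₁; inj₂)
open import Function.Bundles using (mk⇔)
open import Relation.Binary.PropositionalEquality
open import Relation.Nullary using (yes; no; does; ¬_)
open import Relation.Nullary.Decidable using (does-⇔)
open import Algebra.Structures {A = ℚω} _≡_ using (IsCommutativeRing)
open import Tactic.RingSolver using (solve-∀)
open import Tactic.RingSolver.Core.AlmostCommutativeRing
  using (AlmostCommutativeRing; fromCommutativeRing)

open ≡-Reasoning

-- ℚ(ω) as a commutative ring

negω : ℚω → ℚω
negω (mkω a b) = mkω (ℚ.- a) (ℚ.- b)

0ω 1ω : ℚω
0ω = ι 0ℚ
1ω = ι 1ℚ

⊕-assoc : ∀ x y z → (x ⊕ y) ⊕ z ≡ x ⊕ (y ⊕ z)
⊕-assoc (mkω a b) (mkω c d) (mkω e f) = cong₂ mkω (ℚₚ.+-assoc a c e) (ℚₚ.+-assoc b d f)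

⊕-comm : ∀ x y → x ⊕ y ≡ y ⊕ x
⊕-comm (mkω a b) (mkω c d) = cong₂ mkω (ℚₚ.+-comm a c) (ℚₚ.+-comm b d)

⊕-identityˡ : ∀ x → 0ω ⊕ x ≡ x
⊕-identityˡ (mkω a b) = cong₂ mkω (ℚₚ.+-identityˡ a) (ℚₚ.+-identityˡ b)

⊕-identityʳ : ∀ x → x ⊕ 0ω ≡ x
⊕-identityʳ (mkω a b) = cong₂ mkω (ℚₚ.+-identityʳ a) (ℚₚ.+-identityʳ b)

⊕-inverseˡ : ∀ x → negω x ⊕ x ≡ 0ω
⊕-inverseˡ (mkω a b) = cong₂ mkω (ℚₚ.+-inverseˡ a) (ℚₚ.+-inverseˡ b)

⊕-inverseʳ : ∀ x → x ⊕ negω x ≡ 0ω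
⊕-inverseʳ (mkω a b) = cong₂ mkω (ℚₚ.+-inverseʳ a) (ℚₚ.+-inverseʳ b)

⊗-assoc : ∀ x y z → (x ⊗ y) ⊗ z ≡ x ⊗ (y ⊗ z)
⊗-assoc (mkω a b) (mkω c d) (mkω e f) = cong₂ mkω
  (solve 6 (λ a b c d e f → (a :* c :- b :* d) :* e :- (a :* d :+ b :* c :- b :* d) :* f
     := a :* (c :* e :- d :* f) :- b :* (c :* f :+ d :* e :- d :* f)) refl a b c d e f)
  (solve 6 (λ a b c d e f → (a :* c :- b :* d) :* f :+ (a :* d :+ b :* c :- b :* d) :* e
                              :- (a :* d :+ b :* c :- b :* d) :* f
     := a :* (c :* f :+ d :* e :- d :* f) :+ b :* (c :* e :- d :* f)
          :- b :* (c :* f :+ d :* e :- d :* f)) refl a b c d e f)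
  where open ℚ-Solver

⊗-comm : ∀ x y → x ⊗ y ≡ y ⊗ x
⊗-comm (mkω a b) (mkω c d) = cong₂ mkω
  (solve 4 (λ a b c d → a :* c :- b :* d := c :* a :- d :* b) refl a b c d)
  (solve 4 (λ a b c d → a :* d :+ b :* c :- b :* d := c :* b :+ d :* a :- d :* b) refl a b c d)
  where open ℚ-Solver

⊗-identityˡ : ∀ x → 1ω ⊗ x ≡ x
⊗-identityˡ (mkω a b) = cong₂ mkω
  (solve 2 (λ a b → con 1ℚ :* a :- con 0ℚ :* b := a) refl a b)
  (solve 2 (λ a b → con 1ℚ :* b :+ con 0ℚ :* a :- con 0ℚ :* b := b) refl a b)
  where open ℚ-Solver

⊗-distribˡ-⊕ : ∀ x y z → x ⊗ (y ⊕ z) ≡ (x ⊗ y) ⊕ (x ⊗ z)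
⊗-distribˡ-⊕ (mkω a b) (mkω c d) (mkω e f) = cong₂ mkω
  (solve 6 (λ a b c d e f → a :* (c :+ e) :- b :* (d :+ f)
     := (a :* c :- b :* d) :+ (a :* e :- b :* f)) refl a b c d e f)
  (solve 6 (λ a b c d e f → a :* (d :+ f) :+ b :* (c :+ e) :- b :* (d :+ f)
     := (a :* d :+ b :* c :- b :* d) :+ (a :* f :+ b :* e :- b :* f)) refl a b c d e f)
  where open ℚ-Solver

ℚω-isCommutativeRing : IsCommutativeRing _⊕_ _⊗_ negω 0ω 1ω
ℚω-isCommutativeRing = record
  { isRing = record
    { +-isAbelianGroup = record
      { isGroup = record
        { isMonoid = record
          { isSemigroup = record
            { isMagma = record { isEquivalence = isEquivalence ; ∙-cong = cong₂ _⊕_ }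
            ; assoc = ⊕-assoc }
          ; identity = ⊕-identityˡ , ⊕-identityʳ }
        ; inverse = ⊕-inverseˡ , ⊕-inverseʳ
        ; ⁻¹-cong = cong negω }
      ; comm = ⊕-comm }
    ; *-cong = cong₂ _⊗_
    ; *-assoc = ⊗-assoc
    ; *-identity = ⊗-identityˡ , λ x → trans (⊗-comm x 1ω) (⊗-identityˡ x)
    ; distrib = ⊗-distribˡ-⊕ , λ x y z → trans (⊗-comm (y ⊕ z) x)
        (trans (⊗-distribˡ-⊕ x y z) (cong₂ _⊕_ (⊗-comm x y) (⊗-comm x z))) }
  ; *-comm = ⊗-comm }

ℚω-commutativeRing : CommutativeRing _ _
ℚω-commutativeRing = record { isCommutativeRing = ℚω-isCommutativeRing }

ℚω-ring : AlmostCommutativeRing _ _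
ℚω-ring = fromCommutativeRing ℚω-commutativeRing 0ω≟
  where
  0ω≟ : ∀ x → Maybe (0ω ≡ x)
  0ω≟ (mkω a b) with 0ℚ ℚₚ.≟ a | 0ℚ ℚₚ.≟ b
  ... | yes refl | yes refl = just refl
  ... | _        | _        = nothing

ℚ-ring : AlmostCommutativeRing _ _
ℚ-ring = fromCommutativeRing ℚₚ.+-*-commutativeRing 0ℚ≟
  where
  0ℚ≟ : ∀ x → Maybe (0ℚ ≡ x)
  0ℚ≟ x with 0ℚ ℚₚ.≟ x
  ... | yes 0≡x = just 0≡x
  ... | no  _   = nothing

open CommutativeRing ℚω-commutativeRing using (zeroˡ; zeroʳ; *-identityʳ; commutativeSemiring)
open import Algebra.Properties.Monoid.Mult (CommutativeRing.+-monoid ℚω-commutativeRing) using (_×_)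
open import Algebra.Properties.Semiring.Mult (CommutativeRing.semiring ℚω-commutativeRing) using (×1-homo-*; ×-assoc-*)
open import Algebra.Properties.CommutativeSemiring.Binomial commutativeSemiring using (binomialExpansion) renaming (theorem to binomial-theorem)
open import Algebra.Properties.Monoid.Sum (CommutativeRing.+-monoid ℚω-commutativeRing) using (sum)
open import Algebra.Properties.Semiring.Exp (CommutativeRing.semiring ℚω-commutativeRing) using (_^_)

Σω : ℕ → (ℕ → ℚω) → ℚω
Σω zero    f = 0ω
Σω (suc n) f = Σω n f ⊕ f n

Σω-cong-< : ∀ n {f g} → (∀ k → k < n → f k ≡ g k) → Σω n f ≡ Σω n g
Σω-cong-< zero    f≡g = refl
Σω-cong-< (suc n) f≡g =
  cong₂ _⊕_ (Σω-cong-< n (λ k k<n → f≡g k (ℕₚ.m<n⇒m<1+n k<n))) (f≡g n (ℕₚ.n<1+n n))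

Σω-cong : ∀ n {f g} → f ≗ g → Σω n f ≡ Σω n g
Σω-cong n f≗g = Σω-cong-< n (λ k _ → f≗g k)

Σω-zero : ∀ n → Σω n (λ _ → 0ω) ≡ 0ω
Σω-zero zero    = refl
Σω-zero (suc n) = trans (cong (_⊕ 0ω) (Σω-zero n)) (⊕-identityʳ 0ω)

Σω-distrib-⊕ : ∀ n f g → Σω n (λ k → f k ⊕ g k) ≡ Σω n f ⊕ Σω n g
Σω-distrib-⊕ zero    f g = refl
Σω-distrib-⊕ (suc n) f g =
  trans (cong (_⊕ (f n ⊕ g n)) (Σω-distrib-⊕ n f g)) (interchange (Σω n f) (Σω n g) (f n) (g n))
  where
  interchange : ∀ a b c d → (a ⊕ b) ⊕ (c ⊕ d) ≡ (a ⊕ c) ⊕ (b ⊕ d)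
  interchange = solve-∀ ℚω-ring

Σω-distribˡ : ∀ n c f → c ⊗ Σω n f ≡ Σω n (λ k → c ⊗ f k)
Σω-distribˡ zero    c f = zeroʳ c
Σω-distribˡ (suc n) c f =
  trans (⊗-distribˡ-⊕ c (Σω n f) (f n)) (cong (_⊕ (c ⊗ f n)) (Σω-distribˡ n c f))

Σω-distribʳ : ∀ n c f → Σω n f ⊗ c ≡ Σω n (λ k → f k ⊗ c)
Σω-distribʳ n c f = begin
  Σω n f ⊗ c                ≡⟨ ⊗-comm (Σω n f) c ⟩
  c ⊗ Σω n f                ≡⟨ Σω-distribˡ n c f ⟩
  Σω n (λ k → c ⊗ f k)      ≡⟨ Σω-cong n (λ k → ⊗-comm c (f k)) ⟩
  Σω n (λ k → f k ⊗ c)      ∎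

Σω-comm : ∀ m n (f : ℕ → ℕ → ℚω) →
          Σω m (λ i → Σω n (f i)) ≡ Σω n (λ j → Σω m (λ i → f i j))
Σω-comm zero    n f = sym (Σω-zero n)
Σω-comm (suc m) n f = trans (cong (_⊕ Σω n (f m)) (Σω-comm m n f))
  (sym (Σω-distrib-⊕ n (λ j → Σω m (λ i → f i j)) (f m)))

Σω-extend : ∀ {m n} f → m ≤ n → (∀ k → m ≤ k → f k ≡ 0ω) → Σω n f ≡ Σω m f
Σω-extend {m} {zero}  f z≤n     vanish = refl
Σω-extend {m} {suc n} f m≤1+n vanish with m ℕₚ.≟ suc n
... | yes refl = refl
... | no  m≢1+n = begin
  Σω n f ⊕ f n  ≡⟨ cong₂ _⊕_ (Σω-extend f m≤n vanish) (vanish n m≤n) ⟩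
  Σω m f ⊕ 0ω   ≡⟨ ⊕-identityʳ (Σω m f) ⟩
  Σω m f        ∎
  where
  m≤n : m ≤ n
  m≤n = ℕₚ.≤-pred (ℕₚ.≤∧≢⇒< m≤1+n m≢1+n)

Σω-shift : ∀ n f → Σω (suc n) f ≡ f 0 ⊕ Σω n (λ k → f (suc k))
Σω-shift zero    f = trans (⊕-identityˡ (f 0)) (sym (⊕-identityʳ (f 0)))
Σω-shift (suc n) f = trans (cong (_⊕ f (suc n)) (Σω-shift n f)) (⊕-assoc (f 0) _ _)

Σω-reverse : ∀ n f → Σω (suc n) f ≡ Σω (suc n) (λ k → f (n ∸ k))
Σω-reverse zero    f = refl
Σω-reverse (suc n) f = begin
  Σω (suc n) f ⊕ f (suc n)                     ≡⟨ cong (_⊕ f (suc n)) (Σω-reverse n f) ⟩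
  Σω (suc n) (λ k → f (n ∸ k)) ⊕ f (suc n)     ≡⟨ ⊕-comm _ (f (suc n)) ⟩
  f (suc n) ⊕ Σω (suc n) (λ k → f (n ∸ k))     ≡⟨ Σω-shift (suc n) (λ k → f (suc n ∸ k)) ⟨
  Σω (suc (suc n)) (λ k → f (suc n ∸ k))       ∎

Σω≡sum : ∀ n f → Σω n f ≡ sum (λ (k : Fin n) → f (toℕ k))
Σω≡sum zero    f = refl
Σω≡sum (suc n) f = trans (Σω-shift n f) (cong (f 0 ⊕_) (Σω≡sum n (λ k → f (suc k))))

≡-via-ℚᵘ : ∀ {p q u} → ℚ.toℚᵘ p ℚᵘ.≃ u → ℚ.toℚᵘ q ℚᵘ.≃ u → p ≡ q
≡-via-ℚᵘ p≃u q≃u = ℚₚ.toℚᵘ-injective (ℚᵘₚ.≃-trans p≃u (ℚᵘₚ.≃-sym q≃u))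

toℚᵘ-/ : ∀ z d → ℚ.toℚᵘ (z ℚ./ suc d) ℚᵘ.≃ mkℚᵘ z d
toℚᵘ-/ z d = ℚₚ.toℚᵘ-fromℚᵘ (mkℚᵘ z d)

ℕ→ℚ-suc : ∀ n → ℕ→ℚ (suc n) ≡ 1ℚ ℚ.+ ℕ→ℚ n
ℕ→ℚ-suc n = ≡-via-ℚᵘ (toℚᵘ-/ (+ suc n) 0)
  (ℚᵘₚ.≃-trans (ℚₚ.toℚᵘ-homo-+ 1ℚ (ℕ→ℚ n))
  (ℚᵘₚ.≃-trans (ℚᵘₚ.+-congʳ (mkℚᵘ (+ 1) 0) (toℚᵘ-/ (+ n) 0))
    (*≡* (cross-multiplied (+ n)))))
  where
  cross-multiplied : ∀ a → (+ 1 ℤ.* + 1 ℤ.+ a ℤ.* + 1) ℤ.* + 1 ≡ (+ 1 ℤ.+ a) ℤ.* (+ 1 ℤ.* + 1)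
  cross-multiplied = ℤ-Ring.solve-∀

/-split : ∀ z m → z ℚ./ suc m ≡ (z ℚ./ 1) ℚ.* (+ 1 ℚ./ suc m)
/-split z m = ≡-via-ℚᵘ (toℚᵘ-/ z m)
  (ℚᵘₚ.≃-trans (ℚₚ.toℚᵘ-homo-* (z ℚ./ 1) (+ 1 ℚ./ suc m))
  (ℚᵘₚ.≃-trans (ℚᵘₚ.*-cong (toℚᵘ-/ z 0) (toℚᵘ-/ (+ 1) m))
    (*≡* (cross-multiplied z (+ suc m)))))
  where
  cross-multiplied : ∀ a s → (a ℤ.* + 1) ℤ.* s ≡ a ℤ.* (+ 1 ℤ.* s)
  cross-multiplied = ℤ-Ring.solve-∀

ℕ→ℚ*1/≡1 : ∀ m → ℕ→ℚ (suc m) ℚ.* (+ 1 ℚ./ suc m) ≡ 1ℚ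
ℕ→ℚ*1/≡1 m = ≡-via-ℚᵘ
  (ℚᵘₚ.≃-trans (ℚₚ.toℚᵘ-homo-* (ℕ→ℚ (suc m)) (+ 1 ℚ./ suc m))
  (ℚᵘₚ.≃-trans (ℚᵘₚ.*-cong (toℚᵘ-/ (+ suc m) 0) (toℚᵘ-/ (+ 1) m))
    (*≡* (cross-multiplied (+ suc m)))))
  (ℚᵘₚ.≃-refl {mkℚᵘ (+ 1) 0})
  where
  cross-multiplied : ∀ s → (s ℤ.* + 1) ℤ.* + 1 ≡ + 1 ℤ.* (+ 1 ℤ.* s)
  cross-multiplied = ℤ-Ring.solve-∀

ι-* : ∀ a b → ι (a ℚ.* b) ≡ ι a ⊗ ι b
ι-* a b = cong₂ mkω (re-part a b) (im-part a b)
  where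
  re-part : ∀ a b → a ℚ.* b ≡ a ℚ.* b ℚ.- 0ℚ ℚ.* 0ℚ
  re-part = solve-∀ ℚ-ring
  im-part : ∀ a b → 0ℚ ≡ a ℚ.* 0ℚ ℚ.+ 0ℚ ℚ.* b ℚ.- 0ℚ ℚ.* 0ℚ
  im-part = solve-∀ ℚ-ring

ι-Σ< : ∀ n f → ι (Σ< n f) ≡ Σω n (λ k → ι (f k))
ι-Σ< zero    f = refl
ι-Σ< (suc n) f = cong (_⊕ ι (f n)) (ι-Σ< n f)

ι-^ : ∀ x n → ι (x ^ℚ n) ≡ ι x ^ω n
ι-^ x zero    = refl
ι-^ x (suc n) = trans (ι-* x (x ^ℚ n)) (cong (ι x ⊗_) (ι-^ x n))

ℕ→ℚω : ℕ → ℚω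
ℕ→ℚω n = ι (ℕ→ℚ n)

ℕ→ℚω≡×1 : ∀ n → ℕ→ℚω n ≡ n × 1ω
ℕ→ℚω≡×1 zero    = refl
ℕ→ℚω≡×1 (suc n) = trans (cong ι (ℕ→ℚ-suc n)) (cong (1ω ⊕_) (ℕ→ℚω≡×1 n))

ℕ→ℚω-* : ∀ m n → ℕ→ℚω (m ℕ.* n) ≡ ℕ→ℚω m ⊗ ℕ→ℚω n
ℕ→ℚω-* m n = begin
  ℕ→ℚω (m ℕ.* n)          ≡⟨ ℕ→ℚω≡×1 (m ℕ.* n) ⟩
  (m ℕ.* n) × 1ω          ≡⟨ ×1-homo-* m n ⟩
  (m × 1ω) ⊗ (n × 1ω)     ≡⟨ cong₂ _⊗_ (ℕ→ℚω≡×1 m) (ℕ→ℚω≡×1 n) ⟨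
  ℕ→ℚω m ⊗ ℕ→ℚω n         ∎

×≡ℕ→ℚω⊗ : ∀ n x → n × x ≡ ℕ→ℚω n ⊗ x
×≡ℕ→ℚω⊗ n x = begin
  n × x             ≡⟨ cong (n ×_) (⊗-identityˡ x) ⟨
  n × (1ω ⊗ x)      ≡⟨ ×-assoc-* n 1ω x ⟨
  (n × 1ω) ⊗ x      ≡⟨ cong (_⊗ x) (ℕ→ℚω≡×1 n) ⟨
  ℕ→ℚω n ⊗ x        ∎

-- Binomial coefficients and the binomial theorem

∸-comm : ∀ n i k → n ∸ i ∸ k ≡ n ∸ k ∸ i
∸-comm n i k = begin
  n ∸ i ∸ k      ≡⟨ ℕₚ.∸-+-assoc n i k ⟩
  n ∸ (i + k)    ≡⟨ cong (n ∸_) (ℕₚ.+-comm i k) ⟩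
  n ∸ (k + i)    ≡⟨ ℕₚ.∸-+-assoc n k i ⟨
  n ∸ k ∸ i      ∎

nCk*k!*[n∸k]!≡n! : ∀ {n k} → k ≤ n → (n C k) ℕ.* (k ! ℕ.* (n ∸ k) !) ≡ n !
nCk*k!*[n∸k]!≡n! {n} {k} k≤n =
  trans (cong (ℕ._* (k ! ℕ.* (n ∸ k) !)) (nCk≡n!/k![n-k]! k≤n))
        (m/n*n≡m {{ℕₚ._!*_!≢0 k (n ∸ k)}} (k![n∸k]!∣n! k≤n))

trinomial : ∀ {n k i} → k + i ≤ n →
            (n C k) ℕ.* ((n ∸ k) C i) ℕ.* (k ! ℕ.* i ! ℕ.* (n ∸ (k + i)) !) ≡ n !
trinomial {n} {k} {i} k+i≤n = begin
  (n C k) ℕ.* ((n ∸ k) C i) ℕ.* (k ! ℕ.* i ! ℕ.* (n ∸ (k + i)) !)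
    ≡⟨ cong (λ m → (n C k) ℕ.* ((n ∸ k) C i) ℕ.* (k ! ℕ.* i ! ℕ.* m !)) (ℕₚ.∸-+-assoc n k i) ⟨
  (n C k) ℕ.* ((n ∸ k) C i) ℕ.* (k ! ℕ.* i ! ℕ.* (n ∸ k ∸ i) !)
    ≡⟨ regroup (n C k) ((n ∸ k) C i) (k !) (i !) ((n ∸ k ∸ i) !) ⟩
  (n C k) ℕ.* (k ! ℕ.* (((n ∸ k) C i) ℕ.* (i ! ℕ.* (n ∸ k ∸ i) !)))
    ≡⟨ cong (λ m → (n C k) ℕ.* (k ! ℕ.* m)) (nCk*k!*[n∸k]!≡n! i≤n∸k) ⟩
  (n C k) ℕ.* (k ! ℕ.* (n ∸ k) !)
    ≡⟨ nCk*k!*[n∸k]!≡n! (ℕₚ.m+n≤o⇒m≤o k k+i≤n) ⟩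
  n ! ∎
  where
  i≤n∸k : i ≤ n ∸ k
  i≤n∸k = subst (_≤ n ∸ k) (ℕₚ.m+n∸m≡n k i) (ℕₚ.∸-monoˡ-≤ k k+i≤n)
  regroup : ∀ a b c d e → a ℕ.* b ℕ.* (c ℕ.* d ℕ.* e) ≡ a ℕ.* (c ℕ.* (b ℕ.* (d ℕ.* e)))
  regroup = ℕ-Ring.solve-∀

-- Outside the range k + i ≤ n both sides vanish; inside, both are n! / (k! i! (n-k-i)!).
nCk*[n∸k]Ci-comm : ∀ n k i → (n C k) ℕ.* ((n ∸ k) C i) ≡ (n C i) ℕ.* ((n ∸ i) C k)
nCk*[n∸k]Ci-comm n k i with k + i ℕₚ.≤? n
... | yes k+i≤n = ℕₚ.*-cancelʳ-≡ ((n C k) ℕ.* ((n ∸ k) C i)) ((n C i) ℕ.* ((n ∸ i) C k)) d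
        {{ℕₚ.m*n≢0 (k ! ℕ.* i !) ((n ∸ (k + i)) !) {{ℕₚ._!*_!≢0 k i}} {{ℕₚ._!≢0 (n ∸ (k + i))}}}}
        (trans (trinomial {n} {k} {i} k+i≤n)
               (sym (trans (cong ((n C i) ℕ.* ((n ∸ i) C k) ℕ.*_) d-comm)
                           (trinomial {n} {i} {k} (subst (_≤ n) (ℕₚ.+-comm k i) k+i≤n)))))
  where
  d = k ! ℕ.* i ! ℕ.* (n ∸ (k + i)) !
  d-comm : d ≡ i ! ℕ.* k ! ℕ.* (n ∸ (i + k)) !
  d-comm = cong₂ ℕ._*_ (ℕₚ.*-comm (k !) (i !)) (cong (λ m → (n ∸ m) !) (ℕₚ.+-comm k i))
... | no k+i≰n = trans (vanishes k i k+i≰n)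
        (sym (vanishes i k (λ i+k≤n → k+i≰n (subst (_≤ n) (ℕₚ.+-comm i k) i+k≤n))))
  where
  vanishes : ∀ k i → ¬ (k + i ≤ n) → (n C k) ℕ.* ((n ∸ k) C i) ≡ 0
  vanishes k i k+i≰n with k ℕₚ.≤? n
  ... | no k≰n = cong (ℕ._* ((n ∸ k) C i)) (k>n⇒nCk≡0 (ℕₚ.≰⇒> k≰n))
  ... | yes k≤n = trans (cong ((n C k) ℕ.*_) (k>n⇒nCk≡0 (ℕₚ.≰⇒> i≰n∸k))) (ℕₚ.*-zeroʳ (n C k))
    where
    i≰n∸k : ¬ (i ≤ n ∸ k)
    i≰n∸k i≤n∸k = k+i≰n (subst (k + i ≤_) (ℕₚ.m+[n∸m]≡n k≤n) (ℕₚ.+-monoʳ-≤ k i≤n∸k))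

^ω≡^ : ∀ z n → z ^ω n ≡ z ^ n
^ω≡^ z zero    = refl
^ω≡^ z (suc n) = cong (z ⊗_) (^ω≡^ z n)

binomial : ∀ m x y → (x ⊕ y) ^ω m ≡ Σω (suc m) (λ k → ℕ→ℚω (m C k) ⊗ (x ^ω k ⊗ y ^ω (m ∸ k)))
binomial m x y = begin
  (x ⊕ y) ^ω m
    ≡⟨ ^ω≡^ (x ⊕ y) m ⟩
  (x ⊕ y) ^ m
    ≡⟨ binomial-theorem m x y ⟩
  binomialExpansion x y m
    ≡⟨ Σω≡sum (suc m) (λ k → (m C k) × (x ^ k ⊗ y ^ (m ∸ k))) ⟨
  Σω (suc m) (λ k → (m C k) × (x ^ k ⊗ y ^ (m ∸ k)))
    ≡⟨ Σω-cong (suc m) (λ k → trans (×≡ℕ→ℚω⊗ (m C k) _)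
         (cong (ℕ→ℚω (m C k) ⊗_) (sym (cong₂ _⊗_ (^ω≡^ x k) (^ω≡^ y (m ∸ k)))))) ⟩
  Σω (suc m) (λ k → ℕ→ℚω (m C k) ⊗ (x ^ω k ⊗ y ^ω (m ∸ k))) ∎

-- Bernoulli numbers and polynomials

[1+n]Cn≡1+n : ∀ n → suc n C n ≡ suc n
[1+n]Cn≡1+n n = begin
  suc n C n              ≡⟨ nCk≡nC[n∸k] (ℕₚ.n≤1+n n) ⟩
  suc n C (suc n ∸ n)    ≡⟨ cong (suc n C_) (ℕₚ.m+n∸n≡m 1 n) ⟩
  suc n C 1              ≡⟨ nC1≡n (suc n) ⟩
  suc n                  ∎

idx-∷ʳ-< : ∀ xs (a : ℚ) k → k < length xs → idx (xs ∷ʳ a) k ≡ idx xs k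
idx-∷ʳ-< (x ∷ xs) a zero    _         = refl
idx-∷ʳ-< (x ∷ xs) a (suc k) (s≤s k<n) = idx-∷ʳ-< xs a k k<n

idx-∷ʳ-length : ∀ xs (a : ℚ) → idx (xs ∷ʳ a) (length xs) ≡ a
idx-∷ʳ-length []       a = refl
idx-∷ʳ-length (x ∷ xs) a = idx-∷ʳ-length xs a

length-bernTable : ∀ n → length (bernTable n) ≡ n
length-bernTable zero    = refl
length-bernTable (suc n) =
  trans (length-++ (bernTable n)) (trans (ℕₚ.+-comm (length (bernTable n)) 1) (cong suc (length-bernTable n)))

idx-bernTable : ∀ n k → k < n → idx (bernTable n) k ≡ B k
idx-bernTable (suc n) k (s≤s k≤n) with ℕₚ.m≤n⇒m<n∨m≡n k≤n
... | inj₁ k<n  = trans (idx-∷ʳ-< (bernTable n) _ k (subst (k <_) (sym (length-bernTable n)) k<n))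
                        (idx-bernTable n k k<n)
... | inj₂ refl = refl

B≡nextBern : ∀ n → B n ≡ nextBern n (bernTable n)
B≡nextBern n = trans (cong (idx (bernTable (suc n))) (sym (length-bernTable n)))
                     (idx-∷ʳ-length (bernTable n) (nextBern n (bernTable n)))

Bsum : ℕ → ℚ
Bsum m = Σ< m (λ k → ℕ→ℚ (m C k) ℚ.* B k)

Σ<-cong-< : ∀ n {f g} → (∀ k → k < n → f k ≡ g k) → Σ< n f ≡ Σ< n g
Σ<-cong-< zero    f≡g = refl
Σ<-cong-< (suc n) f≡g =
  cong₂ ℚ._+_ (Σ<-cong-< n (λ k k<n → f≡g k (ℕₚ.m<n⇒m<1+n k<n))) (f≡g n (ℕₚ.n<1+n n))

Bsum-≥2 : ∀ m → 2 ≤ m → Bsum m ≡ 0ℚ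
Bsum-≥2 (suc zero) (s≤s ())
Bsum-≥2 (suc (suc j)) _ = begin
  S ℚ.+ ℕ→ℚ (m C suc j) ℚ.* B (suc j)
    ≡⟨ cong₂ (λ c b → S ℚ.+ ℕ→ℚ c ℚ.* b) ([1+n]Cn≡1+n (suc j)) (B≡nextBern (suc j)) ⟩
  S ℚ.+ ℕ→ℚ m ℚ.* ℚ.- ((+ 1 ℚ./ m) ℚ.* S′)
    ≡⟨ cong (λ s → S ℚ.+ ℕ→ℚ m ℚ.* ℚ.- ((+ 1 ℚ./ m) ℚ.* s)) S′≡S ⟩
  S ℚ.+ ℕ→ℚ m ℚ.* ℚ.- ((+ 1 ℚ./ m) ℚ.* S)
    ≡⟨ factor S (ℕ→ℚ m) (+ 1 ℚ./ m) ⟩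
  (1ℚ ℚ.- ℕ→ℚ m ℚ.* (+ 1 ℚ./ m)) ℚ.* S
    ≡⟨ cong (λ c → (1ℚ ℚ.- c) ℚ.* S) (ℕ→ℚ*1/≡1 (suc j)) ⟩
  (1ℚ ℚ.- 1ℚ) ℚ.* S
    ≡⟨ ℚₚ.*-zeroˡ S ⟩
  0ℚ ∎
  where
  m = suc (suc j)
  S = Σ< (suc j) (λ k → ℕ→ℚ (m C k) ℚ.* B k)
  S′ = Σ< (suc j) (λ k → ℕ→ℚ (m C k) ℚ.* idx (bernTable (suc j)) k)
  S′≡S : S′ ≡ S
  S′≡S = Σ<-cong-< (suc j) (λ k k<1+j → cong (ℕ→ℚ (m C k) ℚ.*_) (idx-bernTable (suc j) k k<1+j))
  factor : ∀ s n i → s ℚ.+ n ℚ.* ℚ.- (i ℚ.* s) ≡ (1ℚ ℚ.- n ℚ.* i) ℚ.* s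
  factor = solve-∀ ℚ-ring

Bpolyω : ℕ → ℚω → ℚω
Bpolyω n y = Σω (suc n) (λ k → ℕ→ℚω (n C k) ⊗ (ι (B k) ⊗ y ^ω (n ∸ k)))

ι-Bpoly : ∀ n x → ι (Bpoly n x) ≡ Bpolyω n (ι x)
ι-Bpoly n x = trans (ι-Σ< (suc n) _) (Σω-cong (suc n) (λ k →
  trans (ι-* (ℕ→ℚ (n C k)) (B k ℚ.* x ^ℚ (n ∸ k)))
        (cong (ℕ→ℚω (n C k) ⊗_) (trans (ι-* (B k) (x ^ℚ (n ∸ k))) (cong (ι (B k) ⊗_) (ι-^ x (n ∸ k)))))))

Σω-C-extend : ∀ {m n} → m ≤ n → (g : ℕ → ℚω) →
              Σω (suc n) (λ k → ℕ→ℚω (m C k) ⊗ g k) ≡ Σω (suc m) (λ k → ℕ→ℚω (m C k) ⊗ g k)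
Σω-C-extend m≤n g = Σω-extend _ (s≤s m≤n) (λ k m<k →
  trans (cong (λ c → ℕ→ℚω c ⊗ g k) (k>n⇒nCk≡0 m<k)) (zeroˡ (g k)))

ℕ→ℚω-C-comm : ∀ n i k → ℕ→ℚω (n C i) ⊗ ℕ→ℚω ((n ∸ i) C k) ≡ ℕ→ℚω (n C k) ⊗ ℕ→ℚω ((n ∸ k) C i)
ℕ→ℚω-C-comm n i k = begin
  ℕ→ℚω (n C i) ⊗ ℕ→ℚω ((n ∸ i) C k)     ≡⟨ ℕ→ℚω-* (n C i) ((n ∸ i) C k) ⟨
  ℕ→ℚω ((n C i) ℕ.* ((n ∸ i) C k))      ≡⟨ cong ℕ→ℚω (nCk*[n∸k]Ci-comm n i k) ⟩
  ℕ→ℚω ((n C k) ℕ.* ((n ∸ k) C i))      ≡⟨ ℕ→ℚω-* (n C k) ((n ∸ k) C i) ⟩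
  ℕ→ℚω (n C k) ⊗ ℕ→ℚω ((n ∸ k) C i)     ∎

Bpolyω-+ : ∀ n y z →
           Bpolyω n (y ⊕ z) ≡ Σω (suc n) (λ k → (ℕ→ℚω (n C k) ⊗ Bpolyω (n ∸ k) y) ⊗ z ^ω k)
Bpolyω-+ n y z = begin
  Bpolyω n (y ⊕ z)                                ≡⟨ Σω-cong (suc n) expand ⟩
  Σω (suc n) (λ i → Σω (suc n) (t i))             ≡⟨ Σω-comm (suc n) (suc n) t ⟩
  Σω (suc n) (λ k → Σω (suc n) (λ i → t i k))     ≡⟨ Σω-cong (suc n) collect ⟩
  Σω (suc n) (λ k → (ℕ→ℚω (n C k) ⊗ Bpolyω (n ∸ k) y) ⊗ z ^ω k) ∎
  where
  u : ℕ → ℕ → ℚω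
  u i k = ℕ→ℚω ((n ∸ i) C k) ⊗ (z ^ω k ⊗ y ^ω (n ∸ i ∸ k))
  t : ℕ → ℕ → ℚω
  t i k = ℕ→ℚω (n C i) ⊗ (ι (B i) ⊗ u i k)
  expand : ∀ i → ℕ→ℚω (n C i) ⊗ (ι (B i) ⊗ (y ⊕ z) ^ω (n ∸ i)) ≡ Σω (suc n) (t i)
  expand i = begin
    ℕ→ℚω (n C i) ⊗ (ι (B i) ⊗ (y ⊕ z) ^ω (n ∸ i))
      ≡⟨ cong (λ p → ℕ→ℚω (n C i) ⊗ (ι (B i) ⊗ p))
              (trans (cong (_^ω (n ∸ i)) (⊕-comm y z)) (binomial (n ∸ i) z y)) ⟩
    ℕ→ℚω (n C i) ⊗ (ι (B i) ⊗ Σω (suc (n ∸ i)) (u i))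
      ≡⟨ cong (λ p → ℕ→ℚω (n C i) ⊗ (ι (B i) ⊗ p))
              (Σω-C-extend (ℕₚ.m∸n≤m n i) (λ k → z ^ω k ⊗ y ^ω (n ∸ i ∸ k))) ⟨
    ℕ→ℚω (n C i) ⊗ (ι (B i) ⊗ Σω (suc n) (u i))
      ≡⟨ cong (ℕ→ℚω (n C i) ⊗_) (Σω-distribˡ (suc n) (ι (B i)) (u i)) ⟩
    ℕ→ℚω (n C i) ⊗ Σω (suc n) (λ k → ι (B i) ⊗ u i k)
      ≡⟨ Σω-distribˡ (suc n) (ℕ→ℚω (n C i)) (λ k → ι (B i) ⊗ u i k) ⟩
    Σω (suc n) (t i) ∎
  collect : ∀ k → Σω (suc n) (λ i → t i k) ≡ (ℕ→ℚω (n C k) ⊗ Bpolyω (n ∸ k) y) ⊗ z ^ω k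
  collect k = begin
    Σω (suc n) (λ i → t i k)
      ≡⟨ Σω-cong (suc n) swap ⟩
    Σω (suc n) (λ i → (ℕ→ℚω (n C k) ⊗ v i) ⊗ z ^ω k)
      ≡⟨ Σω-distribʳ (suc n) (z ^ω k) (λ i → ℕ→ℚω (n C k) ⊗ v i) ⟨
    Σω (suc n) (λ i → ℕ→ℚω (n C k) ⊗ v i) ⊗ z ^ω k
      ≡⟨ cong (_⊗ z ^ω k) (Σω-distribˡ (suc n) (ℕ→ℚω (n C k)) v) ⟨
    (ℕ→ℚω (n C k) ⊗ Σω (suc n) v) ⊗ z ^ω k
      ≡⟨ cong (λ p → (ℕ→ℚω (n C k) ⊗ p) ⊗ z ^ω k)
              (Σω-C-extend (ℕₚ.m∸n≤m n k) (λ i → ι (B i) ⊗ y ^ω (n ∸ k ∸ i))) ⟩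
    (ℕ→ℚω (n C k) ⊗ Bpolyω (n ∸ k) y) ⊗ z ^ω k ∎
    where
    v : ℕ → ℚω
    v i = ℕ→ℚω ((n ∸ k) C i) ⊗ (ι (B i) ⊗ y ^ω (n ∸ k ∸ i))
    regroup : ∀ a b c z y → a ⊗ (b ⊗ (c ⊗ (z ⊗ y))) ≡ ((a ⊗ c) ⊗ (b ⊗ y)) ⊗ z
    regroup = solve-∀ ℚω-ring
    swap : ∀ i → t i k ≡ (ℕ→ℚω (n C k) ⊗ v i) ⊗ z ^ω k
    swap i = begin
      t i k
        ≡⟨ regroup (ℕ→ℚω (n C i)) (ι (B i)) (ℕ→ℚω ((n ∸ i) C k)) (z ^ω k) (y ^ω (n ∸ i ∸ k)) ⟩
      ((ℕ→ℚω (n C i) ⊗ ℕ→ℚω ((n ∸ i) C k)) ⊗ (ι (B i) ⊗ y ^ω (n ∸ i ∸ k))) ⊗ z ^ω k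
        ≡⟨ cong₂ (λ c e → (c ⊗ (ι (B i) ⊗ y ^ω e)) ⊗ z ^ω k) (ℕ→ℚω-C-comm n i k) (∸-comm n i k) ⟩
      ((ℕ→ℚω (n C k) ⊗ ℕ→ℚω ((n ∸ k) C i)) ⊗ (ι (B i) ⊗ y ^ω (n ∸ k ∸ i))) ⊗ z ^ω k
        ≡⟨ cong (_⊗ z ^ω k) (⊗-assoc (ℕ→ℚω (n C k)) (ℕ→ℚω ((n ∸ k) C i)) (ι (B i) ⊗ y ^ω (n ∸ k ∸ i))) ⟩
      (ℕ→ℚω (n C k) ⊗ v i) ⊗ z ^ω k ∎

1ω^n≡1ω : ∀ n → 1ω ^ω n ≡ 1ω
1ω^n≡1ω zero    = refl
1ω^n≡1ω (suc n) = trans (cong (1ω ⊗_) (1ω^n≡1ω n)) (⊗-identityˡ 1ω)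

Bpolyω-1 : ∀ m → Bpolyω m 1ω ≡ ι (Bsum m) ⊕ ι (B m)
Bpolyω-1 m = begin
  Bpolyω m 1ω
    ≡⟨ Σω-cong (suc m) term ⟩
  Σω (suc m) (λ k → ι (ℕ→ℚ (m C k) ℚ.* B k))
    ≡⟨ ι-Σ< (suc m) (λ k → ℕ→ℚ (m C k) ℚ.* B k) ⟨
  ι (Bsum m) ⊕ ι (ℕ→ℚ (m C m) ℚ.* B m)
    ≡⟨ cong (λ c → ι (Bsum m) ⊕ ι (ℕ→ℚ c ℚ.* B m)) (nCn≡1 m) ⟩
  ι (Bsum m) ⊕ ι (1ℚ ℚ.* B m)
    ≡⟨ cong (λ b → ι (Bsum m) ⊕ ι b) (ℚₚ.*-identityˡ (B m)) ⟩
  ι (Bsum m) ⊕ ι (B m) ∎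
  where
  term : ∀ k → ℕ→ℚω (m C k) ⊗ (ι (B k) ⊗ 1ω ^ω (m ∸ k)) ≡ ι (ℕ→ℚ (m C k) ℚ.* B k)
  term k = begin
    ℕ→ℚω (m C k) ⊗ (ι (B k) ⊗ 1ω ^ω (m ∸ k))  ≡⟨ cong (λ p → ℕ→ℚω (m C k) ⊗ (ι (B k) ⊗ p)) (1ω^n≡1ω (m ∸ k)) ⟩
    ℕ→ℚω (m C k) ⊗ (ι (B k) ⊗ 1ω)             ≡⟨ cong (ℕ→ℚω (m C k) ⊗_) (*-identityʳ (ι (B k))) ⟩
    ℕ→ℚω (m C k) ⊗ ι (B k)                    ≡⟨ ι-* (ℕ→ℚ (m C k)) (B k) ⟨
    ι (ℕ→ℚ (m C k) ℚ.* B k)                   ∎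

Σω-Bsum : ∀ n y → Σω (suc n) (λ k → (ℕ→ℚω (n C k) ⊗ ι (Bsum (n ∸ k))) ⊗ y ^ω k)
                ≡ ℕ→ℚω n ⊗ y ^ω (n ∸ 1)
Σω-Bsum zero    y = refl
Σω-Bsum (suc p) y = begin
  Σω p f ⊕ f p ⊕ f (suc p)
    ≡⟨ cong₂ (λ a b → a ⊕ f p ⊕ b) (trans (Σω-cong-< p below) (Σω-zero p)) top ⟩
  0ω ⊕ f p ⊕ 0ω
    ≡⟨ unpad (f p) ⟩
  f p
    ≡⟨ cong₂ (λ c m → (ℕ→ℚω c ⊗ ι (Bsum m)) ⊗ y ^ω p) ([1+n]Cn≡1+n p) (ℕₚ.m+n∸n≡m 1 p) ⟩
  (ℕ→ℚω (suc p) ⊗ 1ω) ⊗ y ^ω p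
    ≡⟨ cong (_⊗ y ^ω p) (*-identityʳ (ℕ→ℚω (suc p))) ⟩
  ℕ→ℚω (suc p) ⊗ y ^ω p ∎
  where
  f : ℕ → ℚω
  f k = (ℕ→ℚω (suc p C k) ⊗ ι (Bsum (suc p ∸ k))) ⊗ y ^ω k
  unpad : ∀ a → 0ω ⊕ a ⊕ 0ω ≡ a
  unpad = solve-∀ ℚω-ring
  annihilate : ∀ c a → (c ⊗ 0ω) ⊗ a ≡ 0ω
  annihilate = solve-∀ ℚω-ring
  below : ∀ k → k < p → f k ≡ 0ω
  below k k<p = trans (cong (λ s → (ℕ→ℚω (suc p C k) ⊗ ι s) ⊗ y ^ω k) (Bsum-≥2 (suc p ∸ k) 2≤1+p∸k))
                      (annihilate (ℕ→ℚω (suc p C k)) (y ^ω k))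
    where
    2≤1+p∸k : 2 ≤ suc p ∸ k
    2≤1+p∸k = subst (_≤ suc p ∸ k) (ℕₚ.m+n∸n≡m 2 k) (ℕₚ.∸-monoˡ-≤ k (s≤s k<p))
  top : f (suc p) ≡ 0ω
  top = trans (cong (λ m → (ℕ→ℚω (suc p C suc p) ⊗ ι (Bsum m)) ⊗ y ^ω suc p) (ℕₚ.n∸n≡0 p))
              (annihilate (ℕ→ℚω (suc p C suc p)) (y ^ω suc p))

Bpolyω-reverse : ∀ n y → Σω (suc n) (λ k → (ℕ→ℚω (n C k) ⊗ ι (B (n ∸ k))) ⊗ y ^ω k) ≡ Bpolyω n y
Bpolyω-reverse n y = sym (trans (Σω-reverse n _) (Σω-cong-< (suc n) term))
  where
  term : ∀ k → k < suc n → ℕ→ℚω (n C (n ∸ k)) ⊗ (ι (B (n ∸ k)) ⊗ y ^ω (n ∸ (n ∸ k)))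
                         ≡ (ℕ→ℚω (n C k) ⊗ ι (B (n ∸ k))) ⊗ y ^ω k
  term k (s≤s k≤n) = trans
    (cong₂ (λ c e → ℕ→ℚω c ⊗ (ι (B (n ∸ k)) ⊗ y ^ω e)) (sym (nCk≡nC[n∸k] k≤n)) (ℕₚ.m∸[m∸n]≡n k≤n))
    (sym (⊗-assoc (ℕ→ℚω (n C k)) (ι (B (n ∸ k))) (y ^ω k)))

Bpolyω-difference : ∀ n y → Bpolyω n (y ⊕ 1ω) ≡ ℕ→ℚω n ⊗ y ^ω (n ∸ 1) ⊕ Bpolyω n y
Bpolyω-difference n y = begin
  Bpolyω n (y ⊕ 1ω)
    ≡⟨ cong (Bpolyω n) (⊕-comm y 1ω) ⟩
  Bpolyω n (1ω ⊕ y)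
    ≡⟨ Bpolyω-+ n 1ω y ⟩
  Σω (suc n) (λ k → (ℕ→ℚω (n C k) ⊗ Bpolyω (n ∸ k) 1ω) ⊗ y ^ω k)
    ≡⟨ Σω-cong (suc n) split ⟩
  Σω (suc n) (λ k → s k ⊕ b k)
    ≡⟨ Σω-distrib-⊕ (suc n) s b ⟩
  Σω (suc n) s ⊕ Σω (suc n) b
    ≡⟨ cong₂ _⊕_ (Σω-Bsum n y) (Bpolyω-reverse n y) ⟩
  ℕ→ℚω n ⊗ y ^ω (n ∸ 1) ⊕ Bpolyω n y ∎
  where
  s b : ℕ → ℚω
  s k = (ℕ→ℚω (n C k) ⊗ ι (Bsum (n ∸ k))) ⊗ y ^ω k
  b k = (ℕ→ℚω (n C k) ⊗ ι (B (n ∸ k))) ⊗ y ^ω k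
  distrib : ∀ c p q a → (c ⊗ (p ⊕ q)) ⊗ a ≡ (c ⊗ p) ⊗ a ⊕ (c ⊗ q) ⊗ a
  distrib = solve-∀ ℚω-ring
  split : ∀ k → (ℕ→ℚω (n C k) ⊗ Bpolyω (n ∸ k) 1ω) ⊗ y ^ω k ≡ s k ⊕ b k
  split k = trans (cong (λ p → (ℕ→ℚω (n C k) ⊗ p) ⊗ y ^ω k) (Bpolyω-1 (n ∸ k)))
                  (distrib (ℕ→ℚω (n C k)) (ι (Bsum (n ∸ k))) (ι (B (n ∸ k))) (y ^ω k))

-- Sixth roots of unity

^ω-+ : ∀ z a b → z ^ω (a + b) ≡ z ^ω a ⊗ z ^ω b
^ω-+ z zero    b = sym (⊗-identityˡ (z ^ω b))
^ω-+ z (suc a) b = trans (cong (z ⊗_) (^ω-+ z a b)) (sym (⊗-assoc z (z ^ω a) (z ^ω b)))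

Σω-weighted-powers : ∀ m N (w p a : ℕ → ℚω) →
                     Σω m (λ r → w r ⊗ Σω N (λ k → a k ⊗ p r ^ω k))
                   ≡ Σω N (λ k → a k ⊗ Σω m (λ r → w r ⊗ p r ^ω k))
Σω-weighted-powers m N w p a = begin
  Σω m (λ r → w r ⊗ Σω N (λ k → a k ⊗ p r ^ω k))
    ≡⟨ Σω-cong m (λ r → Σω-distribˡ N (w r) (λ k → a k ⊗ p r ^ω k)) ⟩
  Σω m (λ r → Σω N (λ k → w r ⊗ (a k ⊗ p r ^ω k)))
    ≡⟨ Σω-comm m N (λ r k → w r ⊗ (a k ⊗ p r ^ω k)) ⟩
  Σω N (λ k → Σω m (λ r → w r ⊗ (a k ⊗ p r ^ω k)))
    ≡⟨ Σω-cong N (λ k → Σω-cong m (λ r → exchange (w r) (a k) (p r ^ω k))) ⟩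
  Σω N (λ k → Σω m (λ r → a k ⊗ (w r ⊗ p r ^ω k)))
    ≡⟨ Σω-cong N (λ k → Σω-distribˡ m (a k) (λ r → w r ⊗ p r ^ω k)) ⟨
  Σω N (λ k → a k ⊗ Σω m (λ r → w r ⊗ p r ^ω k)) ∎
  where
  exchange : ∀ a b c → a ⊗ (b ⊗ c) ≡ b ⊗ (a ⊗ c)
  exchange = solve-∀ ℚω-ring

root : ℕ → ℚω
root 0 = 1ω
root 1 = negω 1ω
root 2 = ω
root 3 = negω ω
root 4 = ω ⊗ ω
root 5 = negω (ω ⊗ ω)
root _ = 0ω

sign : ℕ → ℚω
sign r = negω 1ω ^ω r

≡3mod6 : ℕ → Bool
≡3mod6 k = does ((+ 6) ∣? ((+ k) ℤ.- (+ 3)))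

≡3mod6-periodic : ∀ k → ≡3mod6 (6 + k) ≡ ≡3mod6 k
≡3mod6-periodic k = does-⇔ (mk⇔ (λ 6∣ → ∣m+n∣m⇒∣n (subst ((+ 6) ∣_) (shift (+ k)) 6∣) ∣-refl)
                                (λ 6∣ → subst ((+ 6) ∣_) (sym (shift (+ k))) (∣m∣n⇒∣m+n ∣-refl 6∣)))
                           ((+ 6) ∣? ((+ (6 + k)) ℤ.- (+ 3))) ((+ 6) ∣? ((+ k) ℤ.- (+ 3)))
  where
  shift : ∀ a → (+ 6 ℤ.+ a) ℤ.- + 3 ≡ + 6 ℤ.+ (a ℤ.- + 3)
  shift = ℤ-Ring.solve-∀

root^6≡1 : ∀ r → r < 6 → root r ^ω 6 ≡ 1ω
root^6≡1 0 _ = refl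
root^6≡1 1 _ = refl
root^6≡1 2 _ = refl
root^6≡1 3 _ = refl
root^6≡1 4 _ = refl
root^6≡1 5 _ = refl
root^6≡1 (suc (suc (suc (suc (suc (suc r)))))) (s≤s (s≤s (s≤s (s≤s (s≤s (s≤s ()))))))

Σω-sign-root^ : ∀ k → Σω 6 (λ r → sign r ⊗ root r ^ω k) ≡ (if ≡3mod6 k then ℕ→ℚω 6 else 0ω)
Σω-sign-root^ 0 = refl
Σω-sign-root^ 1 = refl
Σω-sign-root^ 2 = refl
Σω-sign-root^ 3 = refl
Σω-sign-root^ 4 = refl
Σω-sign-root^ 5 = refl
Σω-sign-root^ (suc (suc (suc (suc (suc (suc k)))))) = begin
  Σω 6 (λ r → sign r ⊗ root r ^ω (6 + k))
    ≡⟨ Σω-cong-< 6 (λ r r<6 → cong (sign r ⊗_) (periodic r r<6)) ⟩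
  Σω 6 (λ r → sign r ⊗ root r ^ω k)
    ≡⟨ Σω-sign-root^ k ⟩
  (if ≡3mod6 k then ℕ→ℚω 6 else 0ω)
    ≡⟨ cong (if_then ℕ→ℚω 6 else 0ω) (≡3mod6-periodic k) ⟨
  (if ≡3mod6 (6 + k) then ℕ→ℚω 6 else 0ω) ∎
  where
  periodic : ∀ r → r < 6 → root r ^ω (6 + k) ≡ root r ^ω k
  periodic r r<6 = trans (^ω-+ (root r) 6 k)
    (trans (cong (_⊗ root r ^ω k) (root^6≡1 r r<6)) (⊗-identityˡ (root r ^ω k)))

Σω-sign-Bpolyω : ∀ n x → Σω 6 (λ r → sign r ⊗ Bpolyω n (ι x ⊕ root r)) ≡ ℕ→ℚω 6 ⊗ ι (lhs n x)
Σω-sign-Bpolyω n x = begin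
  Σω 6 (λ r → sign r ⊗ Bpolyω n (ι x ⊕ root r))
    ≡⟨ Σω-cong 6 (λ r → cong (sign r ⊗_) (Bpolyω-+ n (ι x) (root r))) ⟩
  Σω 6 (λ r → sign r ⊗ Σω (suc n) (λ k → a k ⊗ root r ^ω k))
    ≡⟨ Σω-weighted-powers 6 (suc n) sign root a ⟩
  Σω (suc n) (λ k → a k ⊗ Σω 6 (λ r → sign r ⊗ root r ^ω k))
    ≡⟨ Σω-cong (suc n) (λ k → trans (cong₂ _⊗_ (a≡ι k) (Σω-sign-root^ k)) (select (≡3mod6 k) _)) ⟩
  Σω (suc n) (λ k → ℕ→ℚω 6 ⊗ ι (term k))
    ≡⟨ Σω-distribˡ (suc n) (ℕ→ℚω 6) (λ k → ι (term k)) ⟨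
  ℕ→ℚω 6 ⊗ Σω (suc n) (λ k → ι (term k))
    ≡⟨ cong (ℕ→ℚω 6 ⊗_) (ι-Σ< (suc n) term) ⟨
  ℕ→ℚω 6 ⊗ ι (lhs n x) ∎
  where
  a : ℕ → ℚω
  a k = ℕ→ℚω (n C k) ⊗ Bpolyω (n ∸ k) (ι x)
  term : ℕ → ℚ
  term k = if ≡3mod6 k then ℕ→ℚ (n C k) ℚ.* Bpoly (n ∸ k) x else 0ℚ
  a≡ι : ∀ k → a k ≡ ι (ℕ→ℚ (n C k) ℚ.* Bpoly (n ∸ k) x)
  a≡ι k = sym (trans (ι-* (ℕ→ℚ (n C k)) (Bpoly (n ∸ k) x)) (cong (ℕ→ℚω (n C k) ⊗_) (ι-Bpoly (n ∸ k) x)))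
  select : ∀ b q → ι q ⊗ (if b then ℕ→ℚω 6 else 0ω) ≡ ℕ→ℚω 6 ⊗ ι (if b then q else 0ℚ)
  select true  q = ⊗-comm (ι q) (ℕ→ℚω 6)
  select false q = zeroʳ (ι q)

-- As 1 + ω + ω² = 0, the points X - ω and X - ω² are the successors of X + ω² and X + ω.
Σω-sign-telescope : (P A : ℚω → ℚω) → (∀ y → P (y ⊕ 1ω) ≡ A y ⊕ P y) → ∀ X →
                    Σω 6 (λ r → sign r ⊗ P (X ⊕ root r))
                  ≡ A X ⊕ A (X ⊕ negω 1ω) ⊖ A (X ⊕ ω) ⊖ A (X ⊕ ω ⊗ ω)
Σω-sign-telescope P A step X = begin
  Σω 6 (λ r → sign r ⊗ P (X ⊕ root r))
    ≡⟨ alternate (P (X ⊕ 1ω)) P₁ P₂ (P (X ⊕ negω ω)) P₄ (P (X ⊕ negω (ω ⊗ ω))) ⟩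
  P (X ⊕ 1ω) ⊖ P₁ ⊕ P₂ ⊖ P (X ⊕ negω ω) ⊕ P₄ ⊖ P (X ⊕ negω (ω ⊗ ω))
    ≡⟨ cong₂ (λ p₀ p₃ → p₀ ⊖ P₁ ⊕ P₂ ⊖ p₃ ⊕ P₄ ⊖ P (X ⊕ negω (ω ⊗ ω))) P₀≡ P₃≡ ⟩
  A X ⊕ (A₁ ⊕ P₁) ⊖ P₁ ⊕ P₂ ⊖ (A₄ ⊕ P₄) ⊕ P₄ ⊖ P (X ⊕ negω (ω ⊗ ω))
    ≡⟨ cong (λ p₅ → A X ⊕ (A₁ ⊕ P₁) ⊖ P₁ ⊕ P₂ ⊖ (A₄ ⊕ P₄) ⊕ P₄ ⊖ p₅) P₅≡ ⟩
  A X ⊕ (A₁ ⊕ P₁) ⊖ P₁ ⊕ P₂ ⊖ (A₄ ⊕ P₄) ⊕ P₄ ⊖ (A₂ ⊕ P₂)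
    ≡⟨ cancel (A X) A₁ A₂ A₄ P₁ P₂ P₄ ⟩
  A X ⊕ A₁ ⊖ A₂ ⊖ A₄ ∎
  where
  P₁ = P (X ⊕ negω 1ω)
  P₂ = P (X ⊕ ω)
  P₄ = P (X ⊕ ω ⊗ ω)
  A₁ = A (X ⊕ negω 1ω)
  A₂ = A (X ⊕ ω)
  A₄ = A (X ⊕ ω ⊗ ω)
  alternate : ∀ p₀ p₁ p₂ p₃ p₄ p₅ →
    0ω ⊕ sign 0 ⊗ p₀ ⊕ sign 1 ⊗ p₁ ⊕ sign 2 ⊗ p₂ ⊕ sign 3 ⊗ p₃ ⊕ sign 4 ⊗ p₄ ⊕ sign 5 ⊗ p₅
    ≡ p₀ ⊕ negω p₁ ⊕ p₂ ⊕ negω p₃ ⊕ p₄ ⊕ negω p₅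
  alternate = solve-∀ ℚω-ring
  cancel : ∀ a₀ a₁ a₂ a₄ p₁ p₂ p₄ →
    a₀ ⊕ (a₁ ⊕ p₁) ⊕ negω p₁ ⊕ p₂ ⊕ negω (a₄ ⊕ p₄) ⊕ p₄ ⊕ negω (a₂ ⊕ p₂)
    ≡ a₀ ⊕ a₁ ⊕ negω a₂ ⊕ negω a₄
  cancel = solve-∀ ℚω-ring
  step-from : ∀ c d → c ⊕ 1ω ≡ d → P (X ⊕ d) ≡ A (X ⊕ c) ⊕ P (X ⊕ c)
  step-from c d c+1≡d = trans (cong P (trans (cong (X ⊕_) (sym c+1≡d)) (sym (⊕-assoc X c 1ω))))
                              (step (X ⊕ c))
  P₀≡ : P (X ⊕ 1ω) ≡ A X ⊕ (A₁ ⊕ P₁)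
  P₀≡ = trans (step X) (cong (A X ⊕_) (trans (cong P (sym (⊕-identityʳ X))) (step-from (negω 1ω) 0ω refl)))
  P₃≡ : P (X ⊕ negω ω) ≡ A₄ ⊕ P₄
  P₃≡ = step-from (ω ⊗ ω) (negω ω) refl
  P₅≡ : P (X ⊕ negω (ω ⊗ ω)) ≡ A₂ ⊕ P₂
  P₅≡ = step-from ω (negω (ω ⊗ ω)) refl

theorem2p1 : (n : ℕ) → n ≥ 1 → (x : ℚ) → ι (lhs n x) ≡ rhs n x
theorem2p1 n _ x = begin
  ι (lhs n x)
    ≡⟨ undo-6 (ι (lhs n x)) ⟩
  ι (+ 1 ℚ./ 6) ⊗ (ℕ→ℚω 6 ⊗ ι (lhs n x))
    ≡⟨ cong (ι (+ 1 ℚ./ 6) ⊗_) (Σω-sign-Bpolyω n x) ⟨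
  ι (+ 1 ℚ./ 6) ⊗ Σω 6 (λ r → sign r ⊗ Bpolyω n (X ⊕ root r))
    ≡⟨ cong (ι (+ 1 ℚ./ 6) ⊗_) (Σω-sign-telescope (Bpolyω n) A (Bpolyω-difference n) X) ⟩
  ι (+ 1 ℚ./ 6) ⊗ (A X ⊕ A (X ⊕ negω 1ω) ⊖ A (X ⊕ ω) ⊖ A (X ⊕ ω ⊗ ω))
    ≡⟨ factor (ι (+ 1 ℚ./ 6)) (ℕ→ℚω n) (X ^ω m) ((X ⊕ negω 1ω) ^ω m) ((X ⊕ ω) ^ω m) ((X ⊕ ω ⊗ ω) ^ω m) ⟩
  (ℕ→ℚω n ⊗ ι (+ 1 ℚ./ 6)) ⊗ S
    ≡⟨ cong (_⊗ S) (trans (sym (ι-* (ℕ→ℚ n) (+ 1 ℚ./ 6))) (cong ι (sym (/-split (+ n) 5)))) ⟩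
  rhs n x ∎
  where
  X = ι x
  m = n ∸ 1
  A : ℚω → ℚω
  A y = ℕ→ℚω n ⊗ y ^ω m
  S = X ^ω m ⊕ (X ⊕ negω 1ω) ^ω m ⊖ (X ⊕ ω) ^ω m ⊖ (X ⊕ ω ⊗ ω) ^ω m
  undo-6 : ∀ a → a ≡ ι (+ 1 ℚ./ 6) ⊗ (ℕ→ℚω 6 ⊗ a)
  undo-6 = solve-∀ ℚω-ring
  factor : ∀ s c p q r t → s ⊗ (c ⊗ p ⊕ c ⊗ q ⊕ negω (c ⊗ r) ⊕ negω (c ⊗ t))
                         ≡ (c ⊗ s) ⊗ (p ⊕ q ⊕ negω r ⊕ negω t)
  factor = solve-∀ ℚω-ring
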